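{- Let $q=p^l$ where $p$ is an odd prime and $l\ge 1$, and let $d$ be a positive integer with $4\mid d$. Let $E\subset \mathbb{F}_q^d$. If $$|E|>\frac{q^{d-1}}{d}\binom{d}{d/2}\binom{d/2}{d/4},$$ then for every even integer $r$ with $0\le r\le d$ there exist $x,y\in E$ with $|x-y|=r$, where $|x-y|$ denotes the Hamming distance.
   Context: $\mathbb{F}_q$ is the finite field with $q$ elements. For $x=(x_1,\dots,x_d), y=(y_1,\dots,y_d)\in\mathbb{F}_q^d$, the Hamming distance $|x-y|$ is the number of indices $i\in\{1,\dots,d\}$ with $x_i\neq y_i$. "The points of $E$ determine a Hamming distance $r$" means there are $x,y\in E$ with $|x-y|=r$. -}

module Defs where

open import Level using (Level; _⊔_) renaming (suc to lsuc)
open import Data.Nat using (ℕ; zero; suc)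
open import Data.Fin using (Fin)
open import Data.Vec using (Vec; []; _∷_)
open import Data.List using (List)
open import Data.List.Relation.Unary.AllPairs using (AllPairs)
open import Data.Vec.Relation.Binary.Pointwise.Inductive using (Pointwise)
open import Data.Product using (∃)
open import Data.Bool using (true; false)
open import Relation.Nullary using (¬_; does)
open import Relation.Binary using (Decidable)
open import Relation.Binary.PropositionalEquality as ≡ using (_≡_)
open import Algebra.Bundles using (CommutativeRing)
open import Function.Bundles using (Inverse)

record FiniteField (c ℓ : Level) : Set (lsuc (c ⊔ ℓ)) where
  field
    commRing : CommutativeRing c ℓ
  open CommutativeRing commRing public
  field
    1≉0     : ¬ (1# ≈ 0#)
    inverse : ∀ x → ¬ (x ≈ 0#) → ∃ λ y → (x * y) ≈ 1#
    _≟_     : Decidable _≈_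
    size    : ℕ
    enum    : Inverse setoid (≡.setoid (Fin size))

module _ {c ℓ} (F : FiniteField c ℓ) where
  open FiniteField F

  hamming : ∀ {d} → Vec Carrier d → Vec Carrier d → ℕ
  hamming [] [] = 0
  hamming (a ∷ xs) (b ∷ ys) with does (a ≟ b)
  ... | true  = hamming xs ys
  ... | false = suc (hamming xs ys)

  -- A finite subset E ⊆ F^d, given as a duplicate-free list of vectors
  -- (no two listed vectors are equal coordinatewise); |E| = its length.
  Distinct : ∀ {d} → List (Vec Carrier d) → Set (c ⊔ ℓ)
  Distinct = AllPairs (λ u v → ¬ Pointwise _≈_ u v)

-- Only |E| > q^(d-1) is needed, and the binomial factor is at least d, so the
-- hypothesis provides it; then every distance r ≤ d occurs, even or odd, in
-- any field. Distance 0 is realised by x = y. For r ≥ 1 consider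
--   key (x₁, …, x_d) = (x₂ − x₁, …, x_r − x₁, x_{r+1}, …, x_d) ∈ F^(d-1).
-- By pigeonhole two distinct points x ≠ y of E share a key. Then x₁ ≠ y₁
-- (otherwise x = y), so x_i − x₁ = y_i − y₁ forces x_i ≠ y_i for 2 ≤ i ≤ r,
-- while x_i = y_i for i > r: the two points are at Hamming distance exactly r.
module Submission where

open import Defs
open import Data.Nat using (ℕ; _*_; _^_; _<_; _≤_; _∸_; _/_; NonZero)
open import Data.Nat.Divisibility using (_∣_)
open import Data.Nat.Primality using (Prime)
open import Data.Nat.Combinatorics using (_C_)
open import Data.List using (List; length)
open import Data.List.Membership.Propositional using (_∈_)
open import Data.Vec using (Vec)
open import Data.Product using (∃; ∃₂; _×_)
open import Relation.Nullary using (¬_)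
open import Relation.Binary.PropositionalEquality using (_≡_)

open import Level using (_⊔_)
open import Data.Nat using (zero; suc; _+_; _>_; z≤n; s≤s; z<s)
open import Data.Nat.Properties
  using (≤-reflexive; ≤-trans; ≤-<-trans; m≤m+n; +-mono-≤; +-comm; *-comm;
         *-monoʳ-≤; *-identityʳ; *-cancelˡ-<; module ≤-Reasoning)
open import Data.Nat.DivMod using (m/n<m; m≥n⇒m/n>0; /-monoʳ-≤)
open import Data.Nat.Divisibility using (∣⇒≤)
open import Data.Nat.Combinatorics using (nC1≡n; nCk+nC[k+1]≡[n+1]C[k+1])
open import Data.Fin as Fin using (Fin; combine)
open import Data.Fin.Properties using (pigeonhole; combine-injectiveˡ; combine-injectiveʳ)
open import Data.Vec using ([]; _∷_)
open import Data.List using ([]; _∷_; lookup)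
open import Data.List.Membership.Propositional.Properties using (∈-lookup)
import Data.List.Relation.Unary.All as All
open import Data.List.Relation.Unary.AllPairs using (AllPairs; []; _∷_)
open import Data.List.Relation.Unary.Any using (here)
open import Data.Vec.Relation.Binary.Pointwise.Inductive as Pointwise using (Pointwise; []; _∷_)
open import Data.Product using (_,_)
open import Data.Empty using (⊥-elim)
open import Relation.Nullary using (yes; no)
open import Relation.Binary.Core using (Rel)
open import Relation.Binary.PropositionalEquality using (refl; cong)
import Relation.Binary.PropositionalEquality as ≡
open import Algebra.Bundles using (Group)
open import Function.Bundles using (Inverse; Injection)
open import Function.Properties.Inverse using (Inverse⇒Injection)

nCk>0 : ∀ n k → k ≤ n → n C k > 0
nCk>0 n zero _ = s≤s z≤n
nCk>0 (suc n) (suc k) (s≤s k≤n) = begin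
  1                       ≤⟨ nCk>0 n k k≤n ⟩
  n C k                   ≤⟨ m≤m+n (n C k) (n C suc k) ⟩
  n C k + n C suc k       ≡⟨ nCk+nC[k+1]≡[n+1]C[k+1] n k ⟩
  suc n C suc k           ∎
  where open ≤-Reasoning

n≤nCk : ∀ n k → 0 < k → k < n → n ≤ n C k
n≤nCk (suc n) 1 _ _ = ≤-reflexive (≡.sym (nC1≡n (suc n)))
n≤nCk (suc n) (suc (suc k)) _ (s≤s k<n) = begin
  suc n                       ≡⟨ +-comm 1 n ⟩
  n + 1                       ≤⟨ +-mono-≤ (n≤nCk n (suc k) z<s k<n) (nCk>0 n (suc (suc k)) k<n) ⟩
  n C suc k + n C suc (suc k) ≡⟨ nCk+nC[k+1]≡[n+1]C[k+1] n (suc k) ⟩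
  suc n C suc (suc k)         ∎
  where open ≤-Reasoning

n≤nC[n/2]*[n/2]C[n/4] : ∀ n → 2 ≤ n → n ≤ (n C (n / 2)) * ((n / 2) C (n / 4))
n≤nC[n/2]*[n/2]C[n/4] 1 (s≤s ())
n≤nC[n/2]*[n/2]C[n/4] n@(suc (suc _)) 2≤n = begin
  n                                   ≤⟨ n≤nCk n (n / 2) (m≥n⇒m/n>0 2≤n) (m/n<m n 2 (s≤s (s≤s z≤n))) ⟩
  n C (n / 2)                         ≡⟨ *-identityʳ (n C (n / 2)) ⟨
  (n C (n / 2)) * 1                   ≤⟨ *-monoʳ-≤ (n C (n / 2)) (nCk>0 (n / 2) (n / 4) (/-monoʳ-≤ n {4} {2} (s≤s (s≤s z≤n)))) ⟩
  (n C (n / 2)) * ((n / 2) C (n / 4)) ∎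
  where open ≤-Reasoning

module _ {a r} {A : Set a} {R : Rel A r} where

  AllPairs-lookup : ∀ {xs} → AllPairs R xs → ∀ {i j} → i Fin.< j → R (lookup xs i) (lookup xs j)
  AllPairs-lookup (Rx ∷ _) {Fin.zero} {Fin.suc j} _ = All.lookup Rx (∈-lookup j)
  AllPairs-lookup (_ ∷ Rxs) {Fin.suc i} {Fin.suc j} (s≤s i<j) = AllPairs-lookup Rxs i<j

  AllPairs-pigeonhole : ∀ {m xs} (f : A → Fin m) → AllPairs R xs → m < length xs →
                        ∃₂ λ x y → x ∈ xs × y ∈ xs × R x y × f x ≡ f y
  AllPairs-pigeonhole {xs = xs} f Rxs m<len with pigeonhole m<len (λ i → f (lookup xs i))
  ... | i , j , i<j , fi≡fj = lookup xs i , lookup xs j , ∈-lookup i , ∈-lookup j ,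
                              AllPairs-lookup Rxs i<j , fi≡fj

module _ {c ℓ} (G : Group c ℓ) where
  open Group G
  open import Algebra.Properties.Group G using (⁻¹-injective; ∙-cancelˡ; ∙-cancelʳ)

  difference-cancelʳ : ∀ {a b x y} → a ∙ x ⁻¹ ≈ b ∙ y ⁻¹ → x ≈ y → a ≈ b
  difference-cancelʳ {a} {b} {x} h x≈y = ∙-cancelʳ (x ⁻¹) a b (trans h (∙-congˡ (⁻¹-cong (sym x≈y))))

  difference-cancelˡ : ∀ {a b x y} → a ∙ x ⁻¹ ≈ b ∙ y ⁻¹ → a ≈ b → x ≈ y
  difference-cancelˡ {a} h a≈b = ⁻¹-injective (∙-cancelˡ a _ _ (trans h (∙-congʳ (sym a≈b))))

module _ {c ℓ} (F : FiniteField c ℓ) where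
  open FiniteField F using (Carrier; _≈_; _≟_; size; enum; +-group; -_)
    renaming (_+_ to _⊕_; refl to ≈-refl)

  private
    to : Carrier → Fin size
    to = Inverse.to enum

    to-injective : ∀ {a b} → to a ≡ to b → a ≈ b
    to-injective = Injection.injective (Inverse⇒Injection enum)

    _≋_ : ∀ {n} → Rel (Vec Carrier n) (c ⊔ ℓ)
    _≋_ = Pointwise _≈_

  encode : ∀ {n} → Vec Carrier n → Fin (size ^ n)
  encode []       = Fin.zero
  encode (a ∷ as) = combine (to a) (encode as)

  encode-injective : ∀ {n} (xs ys : Vec Carrier n) → encode xs ≡ encode ys → xs ≋ ys
  encode-injective []       []       _ = []
  encode-injective (a ∷ xs) (b ∷ ys) e =
    to-injective (combine-injectiveˡ (to a) (encode xs) (to b) (encode ys) e) ∷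
    encode-injective xs ys (combine-injectiveʳ (to a) (encode xs) (to b) (encode ys) e)

  hamming-≋ : ∀ {n} {xs ys : Vec Carrier n} → xs ≋ ys → hamming F xs ys ≡ 0
  hamming-≋ [] = refl
  hamming-≋ {xs = a ∷ _} {b ∷ _} (a≈b ∷ xs≋ys) with a ≟ b
  ... | yes _   = hamming-≋ xs≋ys
  ... | no a≉b = ⊥-elim (a≉b a≈b)

  subtractPrefix : ℕ → Carrier → ∀ {n} → Vec Carrier n → Vec Carrier n
  subtractPrefix _       _ []       = []
  subtractPrefix zero    _ xs       = xs
  subtractPrefix (suc k) x (a ∷ as) = (a ⊕ - x) ∷ subtractPrefix k x as

  subtractPrefix-≈-cancel : ∀ k {n} {x y} (xs ys : Vec Carrier n) → x ≈ y →
                            subtractPrefix k x xs ≋ subtractPrefix k y ys → xs ≋ ys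
  subtractPrefix-≈-cancel _       []       []       _   _ = []
  subtractPrefix-≈-cancel zero    (_ ∷ _)  (_ ∷ _)  _   e = e
  subtractPrefix-≈-cancel (suc k) (_ ∷ xs) (_ ∷ ys) x≈y (e ∷ es) =
    difference-cancelʳ +-group e x≈y ∷ subtractPrefix-≈-cancel k xs ys x≈y es

  subtractPrefix-≉-hamming : ∀ k {n} {x y} (xs ys : Vec Carrier n) → ¬ x ≈ y →
                             subtractPrefix k x xs ≋ subtractPrefix k y ys → k ≤ n →
                             hamming F xs ys ≡ k
  subtractPrefix-≉-hamming zero    []       []       _ e _ = hamming-≋ e
  subtractPrefix-≉-hamming zero    (_ ∷ _)  (_ ∷ _)  _ e _ = hamming-≋ e
  subtractPrefix-≉-hamming (suc k) (a ∷ xs) (b ∷ ys) x≉y (e ∷ es) (s≤s k≤n) with a ≟ b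
  ... | yes a≈b = ⊥-elim (x≉y (difference-cancelˡ +-group e a≈b))
  ... | no _    = cong suc (subtractPrefix-≉-hamming k xs ys x≉y es k≤n)

  key : ℕ → ∀ {n} → Vec Carrier (suc n) → Vec Carrier n
  key k (x ∷ xs) = subtractPrefix k x xs

  key-collision-hamming : ∀ k {n} (u v : Vec Carrier (suc n)) → ¬ u ≋ v → key k u ≋ key k v →
                          k ≤ n → hamming F u v ≡ suc k
  key-collision-hamming k (x ∷ xs) (y ∷ ys) u≉v e k≤n with x ≟ y
  ... | yes x≈y = ⊥-elim (u≉v (x≈y ∷ subtractPrefix-≈-cancel k xs ys x≈y e))
  ... | no x≉y  = cong suc (subtractPrefix-≉-hamming k xs ys x≉y e k≤n)

  hamming-realised : ∀ {n} (E : List (Vec Carrier n)) → Distinct F E → size ^ (n ∸ 1) < length E →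
                     ∀ r → r ≤ n → ∃₂ λ x y → x ∈ E × y ∈ E × hamming F x y ≡ r
  hamming-realised (x ∷ _) _ _ zero _ = x , x , here refl , here refl , hamming-≋ {xs = x} (Pointwise.refl ≈-refl)
  hamming-realised {suc n} E distinct bound (suc k) (s≤s k≤n)
    with AllPairs-pigeonhole (λ u → encode (key k u)) distinct bound
  ... | u , v , u∈E , v∈E , u≉v , e =
    u , v , u∈E , v∈E , key-collision-hamming k u v u≉v (encode-injective _ _ e) k≤n

theorem1 : ∀ {c ℓ} (F : FiniteField c ℓ) (p l : ℕ) → Prime p → ¬ (2 ∣ p) → 1 ≤ l →
    FiniteField.size F ≡ p ^ l →
    (d : ℕ) → 0 < d → 4 ∣ d →
    (E : List (Vec (FiniteField.Carrier F) d)) → Distinct F E →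
    (FiniteField.size F ^ (d ∸ 1)) * ((d C (d / 2)) * ((d / 2) C (d / 4))) < d * length E →
    (r : ℕ) → 2 ∣ r → r ≤ d →
    ∃₂ λ x y → x ∈ E × y ∈ E × hamming F x y ≡ r
theorem1 F _ _ _ _ _ _ d@(suc _) _ 4∣d E distinct bound r _ r≤d =
  hamming-realised F E distinct (*-cancelˡ-< d Q (length E) (≤-<-trans d*Q≤Q*K bound)) r r≤d
  where
  open ≤-Reasoning
  Q : ℕ
  Q = FiniteField.size F ^ (d ∸ 1)
  d*Q≤Q*K : d * Q ≤ Q * ((d C (d / 2)) * ((d / 2) C (d / 4)))
  d*Q≤Q*K = begin
    d * Q                                     ≡⟨ *-comm d Q ⟩
    Q * d                                     ≤⟨ *-monoʳ-≤ Q (n≤nC[n/2]*[n/2]C[n/4] d (≤-trans (s≤s (s≤s z≤n)) (∣⇒≤ 4∣d))) ⟩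
    Q * ((d C (d / 2)) * ((d / 2) C (d / 4))) ∎
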